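{- Let $\mathfrak A$ be a J-algebra and let $a,b\in A$ satisfy $a^{\smile};a\le1'$, $b^{\smile};b\le1'$, $1=a^{\smile};b$, $1=a;1=b;1$, and $a;a^{\smile}\cdot b;b^{\smile}\le1'$. Let \begin{align*} K&=a,\quad L=b,\quad U=a^{\smile}\cdot b^{\smile},\quad P=a;b^{\smile}\cdot b;a^{\smile},\quad P_0=a;P;a^{\smile}\cdot b;b^{\smile},\\ A=R&=a;(a^{\smile})^2\cdot b;a;b^{\smile};a^{\smile}\cdot b^2;b^{\smile},\quad R_0=a;R;a^{\smile}\cdot b;b^{\smile},\\ C&=a;(b^{\smile})^2\cdot b;a;a^{\smile}\cdot b^2;a^{\smile};b^{\smile},\quad B=a;a^{\smile}\cdot b;A;b^{\smile},\\ \pi_0&=a;a^{\smile};b^{\smile}\cdot b;a;a^{\smile}\cdot b^2;(b^{\smile})^2. \end{align*} Then $K$, $L$, $U$, $U^{\smile}$ are functional and $P$, $P_0$, $R$, $R_0$, $A$, $B$, $C$, $\pi_0$ are permutational.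
   Context: A J-algebra is an algebra $\langle A,\cdot,0,1,;,{}^{\smile},1'\rangle$ satisfying for all $x,y,z$: $x\cdot(y\cdot z)=(x\cdot y)\cdot z$, $x\cdot y=y\cdot x$, $x\cdot x=x$, $x;(y;z)=(x;y);z$, $x;1'=x$, $(x\cdot y);z=(x\cdot y);z\cdot y;z$, $x^{\smile\smile}=x$, $(x;y)^{\smile}=y^{\smile};x^{\smile}$, $(x\cdot y)^{\smile}=x^{\smile}\cdot y^{\smile}$, $x;y\cdot z=(z;y^{\smile}\cdot x);(y\cdot x^{\smile};z)\cdot z$, $0\cdot x=0$, $x\cdot1=x$, $x;0=0$. Converse binds tightest, then $;$, then $\cdot$; $x^n$ is the $n$-fold relative product. $x\le y$ means $x\cdot y=x$. $x$ is functional if $x^{\smile};x\le1'$ and permutational if $x;x^{\smile}=1'=x^{\smile};x$. -}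

module Defs where

open import Level using (Level; suc; _⊔_)
open import Relation.Binary.PropositionalEquality using (_≡_)
open import Data.Product using (_×_)
import Data.Nat

record JAlgebra (c : Level) : Set (suc c) where
  infixl 6 _·_
  infixl 7 _⨾_
  infix 8 _⌣
  field
    Carrier : Set c
    _·_ : Carrier → Carrier → Carrier
    𝟘 : Carrier
    𝟙 : Carrier
    _⨾_ : Carrier → Carrier → Carrier
    _⌣ : Carrier → Carrier
    𝟙' : Carrier
    ·-assoc : ∀ x y z → x · (y · z) ≡ (x · y) · z
    ·-comm : ∀ x y → x · y ≡ y · x
    ·-idem : ∀ x → x · x ≡ x
    ⨾-assoc : ∀ x y z → x ⨾ (y ⨾ z) ≡ (x ⨾ y) ⨾ z
    ⨾-identityʳ : ∀ x → x ⨾ 𝟙' ≡ x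
    ⨾-·-distrib : ∀ x y z → (x · y) ⨾ z ≡ (x · y) ⨾ z · y ⨾ z
    ⌣-involutive : ∀ x → (x ⌣) ⌣ ≡ x
    ⌣-⨾ : ∀ x y → (x ⨾ y) ⌣ ≡ y ⌣ ⨾ x ⌣
    ⌣-· : ∀ x y → (x · y) ⌣ ≡ x ⌣ · y ⌣
    modular : ∀ x y z → x ⨾ y · z ≡ (z ⨾ y ⌣ · x) ⨾ (y · x ⌣ ⨾ z) · z
    𝟘-· : ∀ x → 𝟘 · x ≡ 𝟘
    ·-𝟙 : ∀ x → x · 𝟙 ≡ x
    ⨾-𝟘 : ∀ x → x ⨾ 𝟘 ≡ 𝟘

  infix 4 _≤_
  _≤_ : Carrier → Carrier → Set c
  x ≤ y = x · y ≡ x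

  Functional : Carrier → Set c
  Functional x = x ⌣ ⨾ x ≤ 𝟙'

  Permutational : Carrier → Set c
  Permutational x = (x ⨾ x ⌣ ≡ 𝟙') × (x ⌣ ⨾ x ≡ 𝟙')

  infixr 9 _^[_]
  _^[_] : Carrier → Data.Nat.ℕ → Carrier
  x ^[ Data.Nat.zero ] = 𝟙'
  x ^[ Data.Nat.suc Data.Nat.zero ] = x
  x ^[ Data.Nat.suc (Data.Nat.suc n) ] = x ^[ Data.Nat.suc n ] ⨾ x

-- Call x a map if it is functional and total (𝟙' ≤ x ⨾ x ⌣, equivalently x ⨾ 𝟙 = 𝟙).
-- Two maps f, g give the map ⟨ f , g ⟩ = f ⨾ a ⌣ · g ⨾ b ⌣, as if a and b were the
-- projections of a product: it is functional because a ⨾ a ⌣ · b ⨾ b ⌣ ≤ 𝟙', and total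
-- because a ⌣ ⨾ b = 𝟙.  Since meets distribute over composition with the converse of a
-- map, each of P, R, C, π₀ and of their converses is a nested pairing of composites of
-- a and b, hence a map; a map whose converse is a map is permutational.  P₀, R₀ and B
-- are the pairings of a ⨾ P, a ⨾ R and b ⨾ R with b, b and a respectively.
module Submission where

open import Defs
open import Level using (Level)
open import Relation.Binary.PropositionalEquality
  using (_≡_; refl; sym; trans; cong; cong₂; subst; subst₂; isEquivalence)
open import Relation.Binary.Structures using (IsPartialOrder)
open import Relation.Binary.Bundles using (Poset)
open import Data.Product using (_×_; _,_; proj₁)
import Relation.Binary.Reasoning.PartialOrder as PosetReasoning

module JAlgebraProperties {c : Level} (𝔄 : JAlgebra c) where
  open JAlgebra 𝔄

  ≤-reflexive : ∀ {x y} → x ≡ y → x ≤ y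
  ≤-reflexive {x} refl = ·-idem x

  ≤-trans : ∀ {x y z} → x ≤ y → y ≤ z → x ≤ z
  ≤-trans {x} {y} {z} x≤y y≤z =
    trans (cong (_· z) (sym x≤y))
      (trans (sym (·-assoc x y z)) (trans (cong (x ·_) y≤z) x≤y))

  ≤-antisym : ∀ {x y} → x ≤ y → y ≤ x → x ≡ y
  ≤-antisym {x} {y} x≤y y≤x = trans (sym x≤y) (trans (·-comm x y) y≤x)

  ≤-poset : Poset c c c
  ≤-poset = record
    { Carrier = Carrier
    ; _≈_ = _≡_
    ; _≤_ = _≤_
    ; isPartialOrder = record
      { isPreorder = record
        { isEquivalence = isEquivalence
        ; reflexive = ≤-reflexive
        ; trans = ≤-trans
        }
      ; antisym = ≤-antisym
      }
    }

  open PosetReasoning ≤-poset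

  x·y≤x : ∀ x y → x · y ≤ x
  x·y≤x x y = begin-equality
    (x · y) · x ≡⟨ ·-comm (x · y) x ⟩
    x · (x · y) ≡⟨ ·-assoc x x y ⟩
    (x · x) · y ≡⟨ cong (_· y) (·-idem x) ⟩
    x · y       ∎

  x·y≤y : ∀ x y → x · y ≤ y
  x·y≤y x y = trans (sym (·-assoc x y y)) (cong (x ·_) (·-idem y))

  ·-greatest : ∀ {x y z} → z ≤ x → z ≤ y → z ≤ x · y
  ·-greatest {x} {y} {z} z≤x z≤y =
    trans (·-assoc z x y) (trans (cong (_· y) z≤x) z≤y)

  ·-mono : ∀ {x x' y y'} → x ≤ x' → y ≤ y' → x · y ≤ x' · y'
  ·-mono {x} {x'} {y} {y'} x≤x' y≤y' =
    ·-greatest (≤-trans (x·y≤x x y) x≤x') (≤-trans (x·y≤y x y) y≤y')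

  x≤𝟙 : ∀ x → x ≤ 𝟙
  x≤𝟙 = ·-𝟙

  𝟙·x≡x : ∀ x → 𝟙 · x ≡ x
  𝟙·x≡x x = trans (·-comm 𝟙 x) (·-𝟙 x)

  ⌣-injective : ∀ {x y} → x ⌣ ≡ y ⌣ → x ≡ y
  ⌣-injective {x} {y} eq =
    trans (sym (⌣-involutive x)) (trans (cong _⌣ eq) (⌣-involutive y))

  ⌣-mono : ∀ {x y} → x ≤ y → x ⌣ ≤ y ⌣
  ⌣-mono {x} {y} x≤y = trans (sym (⌣-· x y)) (cong _⌣ x≤y)

  ⌣-cancel-≤ : ∀ {x y} → x ⌣ ≤ y ⌣ → x ≤ y
  ⌣-cancel-≤ {x} {y} x⌣≤y⌣ =
    subst₂ _≤_ (⌣-involutive x) (⌣-involutive y) (⌣-mono x⌣≤y⌣)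

  ⨾-monoˡ : ∀ {x y z} → x ≤ y → x ⨾ z ≤ y ⨾ z
  ⨾-monoˡ {x} {y} {z} x≤y = begin-equality
    x ⨾ z · y ⨾ z       ≡⟨ cong (λ w → w ⨾ z · y ⨾ z) x≤y ⟨
    (x · y) ⨾ z · y ⨾ z ≡⟨ ⨾-·-distrib x y z ⟨
    (x · y) ⨾ z         ≡⟨ cong (_⨾ z) x≤y ⟩
    x ⨾ z               ∎

  ⨾-monoʳ : ∀ {x y z} → x ≤ y → z ⨾ x ≤ z ⨾ y
  ⨾-monoʳ {x} {y} {z} x≤y = ⌣-cancel-≤ (begin
    (z ⨾ x) ⌣   ≡⟨ ⌣-⨾ z x ⟩
    x ⌣ ⨾ z ⌣   ≤⟨ ⨾-monoˡ (⌣-mono x≤y) ⟩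
    y ⌣ ⨾ z ⌣   ≡⟨ ⌣-⨾ z y ⟨
    (z ⨾ y) ⌣   ∎)

  ⨾-mono : ∀ {x x' y y'} → x ≤ x' → y ≤ y' → x ⨾ y ≤ x' ⨾ y'
  ⨾-mono x≤x' y≤y' = ≤-trans (⨾-monoˡ x≤x') (⨾-monoʳ y≤y')

  ⨾-·-≤ : ∀ x y z w → (x · y) ⨾ (z · w) ≤ x ⨾ z · y ⨾ w
  ⨾-·-≤ x y z w =
    ·-greatest (⨾-mono (x·y≤x x y) (x·y≤x z w)) (⨾-mono (x·y≤y x y) (x·y≤y z w))

  ⌣-𝟙' : 𝟙' ⌣ ≡ 𝟙'
  ⌣-𝟙' = sym (begin-equality
    𝟙'              ≡⟨ ⌣-involutive 𝟙' ⟨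
    𝟙' ⌣ ⌣          ≡⟨ cong _⌣ (⨾-identityʳ (𝟙' ⌣)) ⟨
    (𝟙' ⌣ ⨾ 𝟙') ⌣   ≡⟨ ⌣-⨾ (𝟙' ⌣) 𝟙' ⟩
    𝟙' ⌣ ⨾ 𝟙' ⌣ ⌣   ≡⟨ cong (𝟙' ⌣ ⨾_) (⌣-involutive 𝟙') ⟩
    𝟙' ⌣ ⨾ 𝟙'       ≡⟨ ⨾-identityʳ (𝟙' ⌣) ⟩
    𝟙' ⌣            ∎)

  ⨾-identityˡ : ∀ x → 𝟙' ⨾ x ≡ x
  ⨾-identityˡ x = ⌣-injective (begin-equality
    (𝟙' ⨾ x) ⌣    ≡⟨ ⌣-⨾ 𝟙' x ⟩
    x ⌣ ⨾ 𝟙' ⌣    ≡⟨ cong (x ⌣ ⨾_) ⌣-𝟙' ⟩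
    x ⌣ ⨾ 𝟙'      ≡⟨ ⨾-identityʳ (x ⌣) ⟩
    x ⌣           ∎)

  ⌣-𝟙 : 𝟙 ⌣ ≡ 𝟙
  ⌣-𝟙 = ≤-antisym (x≤𝟙 (𝟙 ⌣))
    (subst (_≤ 𝟙 ⌣) (⌣-involutive 𝟙) (⌣-mono (x≤𝟙 (𝟙 ⌣))))

  ⌣-⨾⌣ : ∀ x y → (x ⨾ y ⌣) ⌣ ≡ y ⨾ x ⌣
  ⌣-⨾⌣ x y = trans (⌣-⨾ x (y ⌣)) (cong (_⨾ x ⌣) (⌣-involutive y))

  ⌣-⌣⨾⌣ : ∀ x y → (x ⌣ ⨾ y ⌣) ⌣ ≡ y ⨾ x
  ⌣-⌣⨾⌣ x y = trans (⌣-⨾ (x ⌣) (y ⌣)) (cong₂ _⨾_ (⌣-involutive y) (⌣-involutive x))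

  ⌣-⨾⨾⌣ : ∀ x y z → ((x ⨾ y) ⨾ z ⌣) ⌣ ≡ (z ⨾ y ⌣) ⨾ x ⌣
  ⌣-⨾⨾⌣ x y z =
    trans (⌣-⨾⌣ (x ⨾ y) z) (trans (cong (z ⨾_) (⌣-⨾ x y)) (⨾-assoc z (y ⌣) (x ⌣)))

  ⌣-⨾⨾⌣⨾⌣ : ∀ x y z w → (((x ⨾ y) ⨾ z ⌣) ⨾ w ⌣) ⌣ ≡ ((w ⨾ z) ⨾ y ⌣) ⨾ x ⌣
  ⌣-⨾⨾⌣⨾⌣ x y z w = begin-equality
    (((x ⨾ y) ⨾ z ⌣) ⨾ w ⌣) ⌣   ≡⟨ ⌣-⨾⌣ ((x ⨾ y) ⨾ z ⌣) w ⟩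
    w ⨾ ((x ⨾ y) ⨾ z ⌣) ⌣       ≡⟨ cong (w ⨾_) (⌣-⨾⨾⌣ x y z) ⟩
    w ⨾ ((z ⨾ y ⌣) ⨾ x ⌣)       ≡⟨ ⨾-assoc w (z ⨾ y ⌣) (x ⌣) ⟩
    (w ⨾ (z ⨾ y ⌣)) ⨾ x ⌣       ≡⟨ cong (_⨾ x ⌣) (⨾-assoc w z (y ⌣)) ⟩
    ((w ⨾ z) ⨾ y ⌣) ⨾ x ⌣       ∎

  ⌣-⨾⌣⨾⌣ : ∀ x y z → (x ⨾ (y ⌣ ⨾ z ⌣)) ⌣ ≡ (z ⨾ y) ⨾ x ⌣
  ⌣-⨾⌣⨾⌣ x y z = trans (⌣-⨾ x (y ⌣ ⨾ z ⌣)) (cong (_⨾ x ⌣) (⌣-⌣⨾⌣ y z))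

  ⌣-⌣·⌣ : ∀ x y → (x ⌣ · y ⌣) ⌣ ≡ x · y
  ⌣-⌣·⌣ x y = trans (⌣-· (x ⌣) (y ⌣)) (cong₂ _·_ (⌣-involutive x) (⌣-involutive y))

  ⌣-·-· : ∀ x y z → (x · y · z) ⌣ ≡ x ⌣ · y ⌣ · z ⌣
  ⌣-·-· x y z = trans (⌣-· (x · y) z) (cong (_· z ⌣) (⌣-· x y))

  x⌣≡y⇒y⌣≡x : ∀ {x y} → x ⌣ ≡ y → y ⌣ ≡ x
  x⌣≡y⇒y⌣≡x {x} refl = ⌣-involutive x

  xy·z≡y·xz : ∀ x y z → (x · y) · z ≡ y · (x · z)
  xy·z≡y·xz x y z = trans (cong (_· z) (·-comm x y)) (sym (·-assoc y x z))

  dedekind : ∀ x y z → x ⨾ y · z ≤ (x · z ⨾ y ⌣) ⨾ (y · x ⌣ ⨾ z)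
  dedekind x y z = begin
    x ⨾ y · z                              ≡⟨ modular x y z ⟩
    (z ⨾ y ⌣ · x) ⨾ (y · x ⌣ ⨾ z) · z      ≤⟨ x·y≤x _ z ⟩
    (z ⨾ y ⌣ · x) ⨾ (y · x ⌣ ⨾ z)          ≡⟨ cong (_⨾ (y · x ⌣ ⨾ z)) (·-comm _ x) ⟩
    (x · z ⨾ y ⌣) ⨾ (y · x ⌣ ⨾ z)          ∎

  modularʳ : ∀ x y z → x ⨾ y · z ≤ x ⨾ (y · x ⌣ ⨾ z)
  modularʳ x y z = ≤-trans (dedekind x y z) (⨾-monoˡ (x·y≤x x (z ⨾ y ⌣)))

  Total : Carrier → Set c
  Total x = 𝟙' ≤ x ⨾ x ⌣

  Map : Carrier → Set c
  Map x = Functional x × Total x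

  functional-⨾-distribˡ-· : ∀ {f} → Functional f → ∀ x y → f ⨾ (x · y) ≡ f ⨾ x · f ⨾ y
  functional-⨾-distribˡ-· {f} f-fun x y = ≤-antisym
    (·-greatest (⨾-monoʳ (x·y≤x x y)) (⨾-monoʳ (x·y≤y x y)))
    (begin
      f ⨾ x · f ⨾ y               ≤⟨ modularʳ f x (f ⨾ y) ⟩
      f ⨾ (x · f ⌣ ⨾ (f ⨾ y))     ≤⟨ ⨾-monoʳ (·-mono (≤-reflexive refl) f⌣⨾f⨾y≤y) ⟩
      f ⨾ (x · y)                 ∎)
    where
    f⌣⨾f⨾y≤y : f ⌣ ⨾ (f ⨾ y) ≤ y
    f⌣⨾f⨾y≤y = begin
      f ⌣ ⨾ (f ⨾ y)   ≡⟨ ⨾-assoc (f ⌣) f y ⟩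
      (f ⌣ ⨾ f) ⨾ y   ≤⟨ ⨾-monoˡ f-fun ⟩
      𝟙' ⨾ y          ≡⟨ ⨾-identityˡ y ⟩
      y               ∎

  functional-⨾⌣-distribʳ-· : ∀ {g} → Functional g →
                             ∀ x y → (x · y) ⨾ g ⌣ ≡ x ⨾ g ⌣ · y ⨾ g ⌣
  functional-⨾⌣-distribʳ-· {g} g-fun x y = ⌣-injective (begin-equality
    ((x · y) ⨾ g ⌣) ⌣              ≡⟨ ⌣-⨾⌣ (x · y) g ⟩
    g ⨾ (x · y) ⌣                  ≡⟨ cong (g ⨾_) (⌣-· x y) ⟩
    g ⨾ (x ⌣ · y ⌣)                ≡⟨ functional-⨾-distribˡ-· g-fun (x ⌣) (y ⌣) ⟩
    g ⨾ x ⌣ · g ⨾ y ⌣              ≡⟨ cong₂ _·_ (⌣-⨾⌣ x g) (⌣-⨾⌣ y g) ⟨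
    (x ⨾ g ⌣) ⌣ · (y ⨾ g ⌣) ⌣      ≡⟨ ⌣-· (x ⨾ g ⌣) (y ⨾ g ⌣) ⟨
    (x ⨾ g ⌣ · y ⨾ g ⌣) ⌣          ∎)

  functional-· : ∀ {x} → Functional x → ∀ y → Functional (x · y)
  functional-· {x} x-fun y = begin
    (x · y) ⌣ ⨾ (x · y)   ≤⟨ ⨾-mono (⌣-mono (x·y≤x x y)) (x·y≤x x y) ⟩
    x ⌣ ⨾ x               ≤⟨ x-fun ⟩
    𝟙'                    ∎

  functional-⌣·⌣ : ∀ {x y} → x ⨾ x ⌣ · y ⨾ y ⌣ ≤ 𝟙' → Functional (x ⌣ · y ⌣)
  functional-⌣·⌣ {x} {y} injective = begin
    (x ⌣ · y ⌣) ⌣ ⨾ (x ⌣ · y ⌣)         ≡⟨ cong (_⨾ (x ⌣ · y ⌣)) (⌣-⌣·⌣ x y) ⟩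
    (x · y) ⨾ (x ⌣ · y ⌣)               ≤⟨ ⨾-·-≤ x y (x ⌣) (y ⌣) ⟩
    x ⨾ x ⌣ · y ⨾ y ⌣                   ≤⟨ injective ⟩
    𝟙'                                  ∎

  functional-[⌣·⌣]⌣ : ∀ {x} → Functional x → ∀ y → Functional ((x ⌣ · y ⌣) ⌣)
  functional-[⌣·⌣]⌣ {x} x-fun y = subst Functional (sym (⌣-⌣·⌣ x y)) (functional-· x-fun y)

  conjugate-functional-≤ : ∀ {f} → Functional f → ∀ x → (f ⨾ x ⌣) ⌣ ⨾ (f ⨾ x ⌣) ≤ x ⨾ x ⌣
  conjugate-functional-≤ {f} f-fun x = begin
    (f ⨾ x ⌣) ⌣ ⨾ (f ⨾ x ⌣)     ≡⟨ cong (_⨾ (f ⨾ x ⌣)) (⌣-⨾⌣ f x) ⟩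
    (x ⨾ f ⌣) ⨾ (f ⨾ x ⌣)       ≡⟨ ⨾-assoc (x ⨾ f ⌣) f (x ⌣) ⟩
    ((x ⨾ f ⌣) ⨾ f) ⨾ x ⌣       ≡⟨ cong (_⨾ x ⌣) (⨾-assoc x (f ⌣) f) ⟨
    (x ⨾ (f ⌣ ⨾ f)) ⨾ x ⌣       ≤⟨ ⨾-monoˡ (⨾-monoʳ f-fun) ⟩
    (x ⨾ 𝟙') ⨾ x ⌣              ≡⟨ cong (_⨾ x ⌣) (⨾-identityʳ x) ⟩
    x ⨾ x ⌣                     ∎

  functional-⨾ : ∀ {f g} → Functional f → Functional g → Functional (f ⨾ g)
  functional-⨾ {f} {g} f-fun g-fun = begin
    (f ⨾ g) ⌣ ⨾ (f ⨾ g)       ≡⟨ cong (_⨾ (f ⨾ g)) (⌣-⨾ f g) ⟩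
    (g ⌣ ⨾ f ⌣) ⨾ (f ⨾ g)     ≡⟨ ⨾-assoc (g ⌣) (f ⌣) (f ⨾ g) ⟨
    g ⌣ ⨾ (f ⌣ ⨾ (f ⨾ g))     ≡⟨ cong (g ⌣ ⨾_) (⨾-assoc (f ⌣) f g) ⟩
    g ⌣ ⨾ ((f ⌣ ⨾ f) ⨾ g)     ≤⟨ ⨾-monoʳ (⨾-monoˡ f-fun) ⟩
    g ⌣ ⨾ (𝟙' ⨾ g)            ≡⟨ cong (g ⌣ ⨾_) (⨾-identityˡ g) ⟩
    g ⌣ ⨾ g                   ≤⟨ g-fun ⟩
    𝟙'                        ∎

  total-⨾ : ∀ {f g} → Total f → Total g → Total (f ⨾ g)
  total-⨾ {f} {g} f-tot g-tot = begin
    𝟙'                        ≤⟨ f-tot ⟩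
    f ⨾ f ⌣                   ≡⟨ cong (_⨾ f ⌣) (⨾-identityʳ f) ⟨
    (f ⨾ 𝟙') ⨾ f ⌣            ≤⟨ ⨾-monoˡ (⨾-monoʳ g-tot) ⟩
    (f ⨾ (g ⨾ g ⌣)) ⨾ f ⌣     ≡⟨ cong (_⨾ f ⌣) (⨾-assoc f g (g ⌣)) ⟩
    ((f ⨾ g) ⨾ g ⌣) ⨾ f ⌣     ≡⟨ ⨾-assoc (f ⨾ g) (g ⌣) (f ⌣) ⟨
    (f ⨾ g) ⨾ (g ⌣ ⨾ f ⌣)     ≡⟨ cong ((f ⨾ g) ⨾_) (⌣-⨾ f g) ⟨
    (f ⨾ g) ⨾ (f ⨾ g) ⌣       ∎

  map-⨾ : ∀ {f g} → Map f → Map g → Map (f ⨾ g)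
  map-⨾ (f-fun , f-tot) (g-fun , g-tot) = functional-⨾ f-fun g-fun , total-⨾ f-tot g-tot

  ⨾𝟙≡𝟙⇒total : ∀ {x} → x ⨾ 𝟙 ≡ 𝟙 → Total x
  ⨾𝟙≡𝟙⇒total {x} x⨾𝟙≡𝟙 = begin
    𝟙'                   ≡⟨ 𝟙·x≡x 𝟙' ⟨
    𝟙 · 𝟙'               ≡⟨ cong (_· 𝟙') x⨾𝟙≡𝟙 ⟨
    x ⨾ 𝟙 · 𝟙'           ≤⟨ modularʳ x 𝟙 𝟙' ⟩
    x ⨾ (𝟙 · x ⌣ ⨾ 𝟙')   ≡⟨ cong (x ⨾_) (trans (𝟙·x≡x _) (⨾-identityʳ (x ⌣))) ⟩
    x ⨾ x ⌣              ∎

  total⇒⨾𝟙≡𝟙 : ∀ {x} → Total x → x ⨾ 𝟙 ≡ 𝟙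
  total⇒⨾𝟙≡𝟙 {x} x-tot = ≤-antisym (x≤𝟙 (x ⨾ 𝟙)) (begin
    𝟙                 ≡⟨ ⨾-identityˡ 𝟙 ⟨
    𝟙' ⨾ 𝟙            ≤⟨ ⨾-monoˡ x-tot ⟩
    (x ⨾ x ⌣) ⨾ 𝟙     ≡⟨ ⨾-assoc x (x ⌣) 𝟙 ⟨
    x ⨾ (x ⌣ ⨾ 𝟙)     ≤⟨ ⨾-monoʳ (x≤𝟙 (x ⌣ ⨾ 𝟙)) ⟩
    x ⨾ 𝟙             ∎)

  total⇒𝟙⨾⌣≡𝟙 : ∀ {x} → Total x → 𝟙 ⨾ x ⌣ ≡ 𝟙
  total⇒𝟙⨾⌣≡𝟙 {x} x-tot = begin-equality
    𝟙 ⨾ x ⌣     ≡⟨ cong (_⨾ x ⌣) ⌣-𝟙 ⟨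
    𝟙 ⌣ ⨾ x ⌣   ≡⟨ ⌣-⨾ x 𝟙 ⟨
    (x ⨾ 𝟙) ⌣   ≡⟨ cong _⌣ (total⇒⨾𝟙≡𝟙 x-tot) ⟩
    𝟙 ⌣         ≡⟨ ⌣-𝟙 ⟩
    𝟙           ∎

  total-· : ∀ {u v} → 𝟙' ≤ u ⨾ v ⌣ → Total (u · v)
  total-· {u} {v} 𝟙'≤u⨾v⌣ = begin
    𝟙'
      ≡⟨ trans (·-comm (u ⨾ v ⌣) 𝟙') 𝟙'≤u⨾v⌣ ⟨
    u ⨾ v ⌣ · 𝟙'
      ≤⟨ dedekind u (v ⌣) 𝟙' ⟩
    (u · 𝟙' ⨾ v ⌣ ⌣) ⨾ (v ⌣ · u ⌣ ⨾ 𝟙')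
      ≡⟨ cong₂ (λ s t → (u · s) ⨾ (v ⌣ · t))
               (trans (⨾-identityˡ (v ⌣ ⌣)) (⌣-involutive v)) (⨾-identityʳ (u ⌣)) ⟩
    (u · v) ⨾ (v ⌣ · u ⌣)
      ≡⟨ cong ((u · v) ⨾_) (trans (·-comm (v ⌣) (u ⌣)) (sym (⌣-· u v))) ⟩
    (u · v) ⨾ (u · v) ⌣
      ∎

  maps⇒permutational : ∀ {x} → Map x → Map (x ⌣) → Permutational x
  maps⇒permutational {x} (x-fun , x-tot) (x⌣-fun , x⌣-tot) =
    ≤-antisym (subst (λ w → w ⨾ x ⌣ ≤ 𝟙') (⌣-involutive x) x⌣-fun) x-tot ,
    ≤-antisym x-fun (subst (λ w → 𝟙' ≤ x ⌣ ⨾ w) (⌣-involutive x) x⌣-tot)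

  self-converse-map⇒permutational : ∀ {x} → Map x → x ⌣ ≡ x → Permutational x
  self-converse-map⇒permutational x-map x⌣≡x =
    maps⇒permutational x-map (subst Map (sym x⌣≡x) x-map)

  module Pairing (a b : Carrier) (a-map : Map a) (b-map : Map b)
                 (a⌣⨾b≡𝟙 : a ⌣ ⨾ b ≡ 𝟙) (injective : a ⨾ a ⌣ · b ⨾ b ⌣ ≤ 𝟙') where

    ⟨_,_⟩ : Carrier → Carrier → Carrier
    ⟨ f , g ⟩ = f ⨾ a ⌣ · g ⨾ b ⌣

    ⨾b⌣-distrib-· : ∀ x y → (x · y) ⨾ b ⌣ ≡ x ⨾ b ⌣ · y ⨾ b ⌣
    ⨾b⌣-distrib-· = functional-⨾⌣-distribʳ-· (proj₁ b-map)

    map-pair : ∀ {f g} → Map f → Map g → Map ⟨ f , g ⟩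
    map-pair {f} {g} (f-fun , f-tot) (g-fun , g-tot) =
      functional , total-· (subst (𝟙' ≤_) (sym f⨾a⌣⨾[g⨾b⌣]⌣≡𝟙) (x≤𝟙 𝟙'))
      where
      functional : Functional ⟨ f , g ⟩
      functional = begin
        ⟨ f , g ⟩ ⌣ ⨾ ⟨ f , g ⟩
          ≡⟨ cong (_⨾ ⟨ f , g ⟩) (⌣-· (f ⨾ a ⌣) (g ⨾ b ⌣)) ⟩
        ((f ⨾ a ⌣) ⌣ · (g ⨾ b ⌣) ⌣) ⨾ ⟨ f , g ⟩
          ≤⟨ ⨾-·-≤ _ _ _ _ ⟩
        (f ⨾ a ⌣) ⌣ ⨾ (f ⨾ a ⌣) · (g ⨾ b ⌣) ⌣ ⨾ (g ⨾ b ⌣)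
          ≤⟨ ·-mono (conjugate-functional-≤ f-fun a) (conjugate-functional-≤ g-fun b) ⟩
        a ⨾ a ⌣ · b ⨾ b ⌣
          ≤⟨ injective ⟩
        𝟙'
          ∎
      f⨾a⌣⨾[g⨾b⌣]⌣≡𝟙 : (f ⨾ a ⌣) ⨾ (g ⨾ b ⌣) ⌣ ≡ 𝟙
      f⨾a⌣⨾[g⨾b⌣]⌣≡𝟙 = begin-equality
        (f ⨾ a ⌣) ⨾ (g ⨾ b ⌣) ⌣   ≡⟨ cong ((f ⨾ a ⌣) ⨾_) (⌣-⨾⌣ g b) ⟩
        (f ⨾ a ⌣) ⨾ (b ⨾ g ⌣)     ≡⟨ ⨾-assoc f (a ⌣) (b ⨾ g ⌣) ⟨
        f ⨾ (a ⌣ ⨾ (b ⨾ g ⌣))     ≡⟨ cong (f ⨾_) (⨾-assoc (a ⌣) b (g ⌣)) ⟩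
        f ⨾ ((a ⌣ ⨾ b) ⨾ g ⌣)     ≡⟨ cong (λ w → f ⨾ (w ⨾ g ⌣)) a⌣⨾b≡𝟙 ⟩
        f ⨾ (𝟙 ⨾ g ⌣)             ≡⟨ cong (f ⨾_) (total⇒𝟙⨾⌣≡𝟙 g-tot) ⟩
        f ⨾ 𝟙                     ≡⟨ total⇒⨾𝟙≡𝟙 f-tot ⟩
        𝟙                         ∎

    permutational-pair-⨾ˡ : ∀ {x} → Map x → Map (x ⌣) → Permutational ⟨ a ⨾ x , b ⟩
    permutational-pair-⨾ˡ {x} x-map x⌣-map = maps⇒permutational
      (map-pair (map-⨾ a-map x-map) b-map)
      (subst Map (sym pair⌣) (map-pair (map-⨾ a-map x⌣-map) b-map))
      where
      pair⌣ : ⟨ a ⨾ x , b ⟩ ⌣ ≡ ⟨ a ⨾ x ⌣ , b ⟩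
      pair⌣ = trans (⌣-· _ _) (cong₂ _·_ (⌣-⨾⨾⌣ a x a) (⌣-⨾⌣ b b))

    permutational-pair-⨾ʳ : ∀ {x} → Map x → Map (x ⌣) → Permutational ⟨ a , b ⨾ x ⟩
    permutational-pair-⨾ʳ {x} x-map x⌣-map = maps⇒permutational
      (map-pair a-map (map-⨾ b-map x-map))
      (subst Map (sym pair⌣) (map-pair a-map (map-⨾ b-map x⌣-map)))
      where
      pair⌣ : ⟨ a , b ⨾ x ⟩ ⌣ ≡ ⟨ a , b ⨾ x ⌣ ⟩
      pair⌣ = trans (⌣-· _ _) (cong₂ _·_ (⌣-⨾⌣ a a) (⌣-⨾⨾⌣ b x b))

    P R C π₀ : Carrier
    P = a ⨾ b ⌣ · b ⨾ a ⌣
    R = a ⨾ (a ⌣) ^[ 2 ] · b ⨾ a ⨾ b ⌣ ⨾ a ⌣ · b ^[ 2 ] ⨾ b ⌣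
    C = a ⨾ (b ⌣) ^[ 2 ] · b ⨾ a ⨾ a ⌣ · b ^[ 2 ] ⨾ a ⌣ ⨾ b ⌣
    π₀ = a ⨾ a ⌣ ⨾ b ⌣ · b ⨾ a ⨾ a ⌣ · b ^[ 2 ] ⨾ (b ⌣) ^[ 2 ]

    map-P : Map P
    map-P = subst Map (·-comm (b ⨾ a ⌣) (a ⨾ b ⌣)) (map-pair b-map a-map)

    P⌣≡P : P ⌣ ≡ P
    P⌣≡P = trans (⌣-· (a ⨾ b ⌣) (b ⨾ a ⌣))
      (trans (cong₂ _·_ (⌣-⨾⌣ a b) (⌣-⨾⌣ b a)) (·-comm (b ⨾ a ⌣) (a ⨾ b ⌣)))

    map-P⌣ : Map (P ⌣)
    map-P⌣ = subst Map (sym P⌣≡P) map-P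

    R-pairing : R ≡ ⟨ ⟨ a , b ⨾ a ⟩ , b ⨾ b ⟩
    R-pairing = cong (_· b ⨾ b ⨾ b ⌣) (begin-equality
      a ⨾ (a ⌣ ⨾ a ⌣) · b ⨾ a ⨾ b ⌣ ⨾ a ⌣
        ≡⟨ cong (_· b ⨾ a ⨾ b ⌣ ⨾ a ⌣) (⨾-assoc a (a ⌣) (a ⌣)) ⟩
      a ⨾ a ⌣ ⨾ a ⌣ · b ⨾ a ⨾ b ⌣ ⨾ a ⌣
        ≡⟨ functional-⨾⌣-distribʳ-· (proj₁ a-map) (a ⨾ a ⌣) (b ⨾ a ⨾ b ⌣) ⟨
      ⟨ a , b ⨾ a ⟩ ⨾ a ⌣
        ∎)

    R⌣-pairing : R ⌣ ≡ ⟨ a ⨾ a , ⟨ a ⨾ b , b ⟩ ⟩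
    R⌣-pairing = begin-equality
      R ⌣
        ≡⟨ ⌣-·-· _ _ _ ⟩
      (a ⨾ (a ⌣ ⨾ a ⌣)) ⌣ · (b ⨾ a ⨾ b ⌣ ⨾ a ⌣) ⌣ · (b ⨾ b ⨾ b ⌣) ⌣
        ≡⟨ cong₂ _·_ (cong₂ _·_ (⌣-⨾⌣⨾⌣ a a a) (⌣-⨾⨾⌣⨾⌣ b a b a)) (⌣-⨾⨾⌣ b b b) ⟩
      a ⨾ a ⨾ a ⌣ · a ⨾ b ⨾ a ⌣ ⨾ b ⌣ · b ⨾ b ⌣ ⨾ b ⌣
        ≡⟨ ·-assoc _ _ _ ⟨
      a ⨾ a ⨾ a ⌣ · (a ⨾ b ⨾ a ⌣ ⨾ b ⌣ · b ⨾ b ⌣ ⨾ b ⌣)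
        ≡⟨ cong (a ⨾ a ⨾ a ⌣ ·_) (⨾b⌣-distrib-· (a ⨾ b ⨾ a ⌣) (b ⨾ b ⌣)) ⟨
      ⟨ a ⨾ a , ⟨ a ⨾ b , b ⟩ ⟩
        ∎

    C-pairing : C ≡ ⟨ b ⨾ a , ⟨ b ⨾ b , a ⟩ ⟩
    C-pairing = begin-equality
      a ⨾ (b ⌣ ⨾ b ⌣) · b ⨾ a ⨾ a ⌣ · b ⨾ b ⨾ a ⌣ ⨾ b ⌣
        ≡⟨ xy·z≡y·xz _ _ _ ⟩
      b ⨾ a ⨾ a ⌣ · (a ⨾ (b ⌣ ⨾ b ⌣) · b ⨾ b ⨾ a ⌣ ⨾ b ⌣)
        ≡⟨ cong (b ⨾ a ⨾ a ⌣ ·_) (·-comm _ _) ⟩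
      b ⨾ a ⨾ a ⌣ · (b ⨾ b ⨾ a ⌣ ⨾ b ⌣ · a ⨾ (b ⌣ ⨾ b ⌣))
        ≡⟨ cong (λ w → b ⨾ a ⨾ a ⌣ · (b ⨾ b ⨾ a ⌣ ⨾ b ⌣ · w)) (⨾-assoc a (b ⌣) (b ⌣)) ⟩
      b ⨾ a ⨾ a ⌣ · (b ⨾ b ⨾ a ⌣ ⨾ b ⌣ · a ⨾ b ⌣ ⨾ b ⌣)
        ≡⟨ cong (b ⨾ a ⨾ a ⌣ ·_) (⨾b⌣-distrib-· (b ⨾ b ⨾ a ⌣) (a ⨾ b ⌣)) ⟨
      ⟨ b ⨾ a , ⟨ b ⨾ b , a ⟩ ⟩
        ∎

    C⌣-pairing : C ⌣ ≡ ⟨ b ⨾ b , ⟨ a , b ⨾ a ⟩ ⟩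
    C⌣-pairing = begin-equality
      C ⌣
        ≡⟨ ⌣-·-· _ _ _ ⟩
      (a ⨾ (b ⌣ ⨾ b ⌣)) ⌣ · (b ⨾ a ⨾ a ⌣) ⌣ · (b ⨾ b ⨾ a ⌣ ⨾ b ⌣) ⌣
        ≡⟨ cong₂ _·_ (cong₂ _·_ (⌣-⨾⌣⨾⌣ a b b) (⌣-⨾⨾⌣ b a a)) (⌣-⨾⨾⌣⨾⌣ b b a b) ⟩
      b ⨾ b ⨾ a ⌣ · a ⨾ a ⌣ ⨾ b ⌣ · b ⨾ a ⨾ b ⌣ ⨾ b ⌣
        ≡⟨ ·-assoc _ _ _ ⟨
      b ⨾ b ⨾ a ⌣ · (a ⨾ a ⌣ ⨾ b ⌣ · b ⨾ a ⨾ b ⌣ ⨾ b ⌣)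
        ≡⟨ cong (b ⨾ b ⨾ a ⌣ ·_) (⨾b⌣-distrib-· (a ⨾ a ⌣) (b ⨾ a ⨾ b ⌣)) ⟨
      ⟨ b ⨾ b , ⟨ a , b ⨾ a ⟩ ⟩
        ∎

    π₀-pairing : π₀ ≡ ⟨ b ⨾ a , ⟨ a , b ⨾ b ⟩ ⟩
    π₀-pairing = begin-equality
      a ⨾ a ⌣ ⨾ b ⌣ · b ⨾ a ⨾ a ⌣ · b ⨾ b ⨾ (b ⌣ ⨾ b ⌣)
        ≡⟨ xy·z≡y·xz _ _ _ ⟩
      b ⨾ a ⨾ a ⌣ · (a ⨾ a ⌣ ⨾ b ⌣ · b ⨾ b ⨾ (b ⌣ ⨾ b ⌣))
        ≡⟨ cong (λ w → b ⨾ a ⨾ a ⌣ · (a ⨾ a ⌣ ⨾ b ⌣ · w)) (⨾-assoc (b ⨾ b) (b ⌣) (b ⌣)) ⟩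
      b ⨾ a ⨾ a ⌣ · (a ⨾ a ⌣ ⨾ b ⌣ · b ⨾ b ⨾ b ⌣ ⨾ b ⌣)
        ≡⟨ cong (b ⨾ a ⨾ a ⌣ ·_) (⨾b⌣-distrib-· (a ⨾ a ⌣) (b ⨾ b ⨾ b ⌣)) ⟨
      ⟨ b ⨾ a , ⟨ a , b ⨾ b ⟩ ⟩
        ∎

    π₀⌣≡π₀ : π₀ ⌣ ≡ π₀
    π₀⌣≡π₀ = begin-equality
      π₀ ⌣
        ≡⟨ ⌣-·-· _ _ _ ⟩
      (a ⨾ a ⌣ ⨾ b ⌣) ⌣ · (b ⨾ a ⨾ a ⌣) ⌣ · (b ⨾ b ⨾ (b ⌣ ⨾ b ⌣)) ⌣
        ≡⟨ cong₂ _·_ (cong₂ _·_ (x⌣≡y⇒y⌣≡x (⌣-⨾⨾⌣ b a a)) (⌣-⨾⨾⌣ b a a)) self-converse ⟩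
      b ⨾ a ⨾ a ⌣ · a ⨾ a ⌣ ⨾ b ⌣ · b ⨾ b ⨾ (b ⌣ ⨾ b ⌣)
        ≡⟨ cong (_· b ⨾ b ⨾ (b ⌣ ⨾ b ⌣)) (·-comm _ _) ⟩
      π₀
        ∎
      where
      self-converse : (b ⨾ b ⨾ (b ⌣ ⨾ b ⌣)) ⌣ ≡ b ⨾ b ⨾ (b ⌣ ⨾ b ⌣)
      self-converse = trans (⌣-⨾ (b ⨾ b) (b ⌣ ⨾ b ⌣)) (cong₂ _⨾_ (⌣-⌣⨾⌣ b b) (⌣-⨾ b b))

    map-R : Map R
    map-R = subst Map (sym R-pairing)
      (map-pair (map-pair a-map (map-⨾ b-map a-map)) (map-⨾ b-map b-map))

    map-R⌣ : Map (R ⌣)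
    map-R⌣ = subst Map (sym R⌣-pairing)
      (map-pair (map-⨾ a-map a-map) (map-pair (map-⨾ a-map b-map) b-map))

    permutational-R : Permutational R
    permutational-R = maps⇒permutational map-R map-R⌣

    permutational-C : Permutational C
    permutational-C = maps⇒permutational
      (subst Map (sym C-pairing)
        (map-pair (map-⨾ b-map a-map) (map-pair (map-⨾ b-map b-map) a-map)))
      (subst Map (sym C⌣-pairing)
        (map-pair (map-⨾ b-map b-map) (map-pair a-map (map-⨾ b-map a-map))))

    map-π₀ : Map π₀
    map-π₀ = subst Map (sym π₀-pairing)
      (map-pair (map-⨾ b-map a-map) (map-pair a-map (map-⨾ b-map b-map)))

proposition71 : ∀ {c : Level} (𝔄 : JAlgebra c) → let open JAlgebra 𝔄 in
    (a b : Carrier) →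
    Functional a → Functional b →
    𝟙 ≡ a ⌣ ⨾ b → 𝟙 ≡ a ⨾ 𝟙 → 𝟙 ≡ b ⨾ 𝟙 →
    a ⨾ a ⌣ · b ⨾ b ⌣ ≤ 𝟙' →
    let K = a
        L = b
        U = a ⌣ · b ⌣
        P = a ⨾ b ⌣ · b ⨾ a ⌣
        P₀ = a ⨾ P ⨾ a ⌣ · b ⨾ b ⌣
        R = a ⨾ (a ⌣) ^[ 2 ] · b ⨾ a ⨾ b ⌣ ⨾ a ⌣ · b ^[ 2 ] ⨾ b ⌣
        A = R
        R₀ = a ⨾ R ⨾ a ⌣ · b ⨾ b ⌣
        C = a ⨾ (b ⌣) ^[ 2 ] · b ⨾ a ⨾ a ⌣ · b ^[ 2 ] ⨾ a ⌣ ⨾ b ⌣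
        B = a ⨾ a ⌣ · b ⨾ A ⨾ b ⌣
        π₀ = a ⨾ a ⌣ ⨾ b ⌣ · b ⨾ a ⨾ a ⌣ · b ^[ 2 ] ⨾ (b ⌣) ^[ 2 ]
    in (Functional K × Functional L × Functional U × Functional (U ⌣)) ×
       (Permutational P × Permutational P₀ × Permutational R × Permutational R₀ ×
        Permutational A × Permutational B × Permutational C × Permutational π₀)
proposition71 𝔄 a b a-fun b-fun 𝟙≡a⌣⨾b 𝟙≡a⨾𝟙 𝟙≡b⨾𝟙 injective =
  (a-fun , b-fun , functional-⌣·⌣ injective , functional-[⌣·⌣]⌣ a-fun b) ,
  (self-converse-map⇒permutational map-P P⌣≡P , permutational-pair-⨾ˡ map-P map-P⌣ ,
   permutational-R , permutational-pair-⨾ˡ map-R map-R⌣ ,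
   permutational-R , permutational-pair-⨾ʳ map-R map-R⌣ ,
   permutational-C , self-converse-map⇒permutational map-π₀ π₀⌣≡π₀)
  where
  open JAlgebraProperties 𝔄
  open Pairing a b (a-fun , ⨾𝟙≡𝟙⇒total (sym 𝟙≡a⨾𝟙))
                   (b-fun , ⨾𝟙≡𝟙⇒total (sym 𝟙≡b⨾𝟙))
                   (sym 𝟙≡a⌣⨾b) injective
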